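{- Let $\beta,\gamma$ be integers. Let $N_{\beta,\gamma}=\{(u,v)\in\mathbb Z^2: u^2+2\beta uv-(1-2\gamma)v^2=1\}$, let $\phi(u,v)=(u^2-v^2,2uv,u^2+v^2)$, and let $\mathrm{Im}(\bar\phi)=\{\phi(u,v):(u,v)\in N_{\beta,\gamma}\}$. For Pythagorean triples $\mathbf a,\mathbf b$ define $\mathbf a\bullet_{\beta,\gamma}\mathbf b=M_{\beta,\gamma}(\mathbf a).\mathbf b$, where for $(x,y,z)\in\mathbb Z^3$ $$M_{\beta,\gamma}(x,y,z)=\begin{pmatrix} (\gamma^2-\gamma +1-\beta^2)(x - z)+\beta y + z & \beta (x - z) - \gamma y & (\beta^2-\gamma^2+\gamma) (x - z)-\beta y \\ -\beta(2\gamma-1)(x - z) +\gamma y & \gamma (x-z)+\beta y+z & \beta(2\gamma-1)(x - z)+(1-\gamma)y \\ (\beta^2+\gamma^2-\gamma) (x - z)-\beta y & -\beta(x - z)+(1-\gamma)y & -( \beta^2+\gamma^2-\gamma)(x - z)+\beta y + z \end{pmatrix}.$$ Then $(\mathrm{Im}(\bar\phi),\bullet_{\beta,\gamma})$ is a group of Pythagorean triples (with identity $(1,0,1)$), and the inverse of $\phi(u,v)$, for $(u,v)\in N_{\beta,\gamma}$, is $$\phi(u+2\beta v,-v)=\big((u+2\beta v)^2-v^2,\ -2v(u+2\beta v),\ (u+2\beta v)^2+v^2\big).$$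
   Context: A Pythagorean triple is $(x,y,z)\in\mathbb Z^3$ with $x^2+y^2=z^2$. "." denotes the matrix product with triples as column vectors. -}

module Defs where

open import Data.Integer using (ℤ; +_; _+_; _-_; _*_; -_)
open import Data.Product using (Σ; _×_; _,_; ∃)
open import Relation.Binary.PropositionalEquality using (_≡_)

record Triple : Set where
  constructor ⟨_,_,_⟩
  field
    x y z : ℤ
open Triple public

sq : ℤ → ℤ
sq a = a * a

Pythagorean : Triple → Set
Pythagorean t = sq (x t) + sq (y t) ≡ sq (z t)

InN : ℤ → ℤ → ℤ → ℤ → Set
InN β γ u v = sq u + (+ 2) * β * u * v - (+ 1 - (+ 2) * γ) * sq v ≡ + 1

φ : ℤ → ℤ → Triple
φ u v = ⟨ sq u - sq v , (+ 2) * u * v , sq u + sq v ⟩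

InIm : ℤ → ℤ → Triple → Set
InIm β γ t = Σ ℤ λ u → Σ ℤ λ v → InN β γ u v × φ u v ≡ t

-- 3×3 integer matrices, given by their rows (each a Triple).
record Mat3 : Set where
  constructor mat
  field
    r₁ r₂ r₃ : Triple
open Mat3 public

dot : Triple → Triple → ℤ
dot a b = x a * x b + y a * y b + z a * z b

_·_ : Mat3 → Triple → Triple
A · b = ⟨ dot (r₁ A) b , dot (r₂ A) b , dot (r₃ A) b ⟩

M : ℤ → ℤ → Triple → Mat3
M β γ ⟨ a , b , c ⟩ =
  let d = a - c in
  mat ⟨ (sq γ - γ + + 1 - sq β) * d + β * b + c
      , β * d - γ * b
      , (sq β - sq γ + γ) * d - β * b ⟩
      ⟨ - (β * ((+ 2) * γ - + 1) * d) + γ * b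
      , γ * d + β * b + c
      , β * ((+ 2) * γ - + 1) * d + (+ 1 - γ) * b ⟩
      ⟨ (sq β + sq γ - γ) * d - β * b
      , - (β * d) + (+ 1 - γ) * b
      , - ((sq β + sq γ - γ) * d) + β * b + c ⟩

bullet : ℤ → ℤ → Triple → Triple → Triple
bullet β γ a b = M β γ a · b

e : Triple
e = ⟨ + 1 , + 0 , + 1 ⟩

{-# OPTIONS --safe #-}
module Submission where

-- Read (u , v) as u + vω in ℤ[ω], where ω² = 2βω + (1 − 2γ). Then the defining form of
-- N_{β,γ} is the norm, N_{β,γ} is the group of norm-one elements, and the inverse of u + vω
-- is its conjugate (u + 2βv) − vω. A direct expansion shows φ(p) • φ(q) = φ(p q), so φ maps
-- the multiplication of ℤ[ω] onto •; the group axioms of Im(φ̄) are then those of N_{β,γ}.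

open import Defs
open import Data.Integer using (ℤ; +_; _+_; _*_; -_; _-_)
open import Data.Integer.Tactic.RingSolver using (solve-∀)
open import Data.Product using (_×_; _,_; uncurry)
open import Relation.Binary.PropositionalEquality
  using (_≡_; refl; sym; trans; cong; cong₂; subst; module ≡-Reasoning)

⟨,,⟩-cong : ∀ {a b c a′ b′ c′} → a ≡ a′ → b ≡ b′ → c ≡ c′ → ⟨ a , b , c ⟩ ≡ ⟨ a′ , b′ , c′ ⟩
⟨,,⟩-cong refl refl refl = refl

-- solve-∀ does not unfold definitions, so each identity it proves below is stated with the
-- relevant definitions written out; the stated form is definitionally the one needed.
φ-pythagorean : ∀ u v → Pythagorean (φ u v)
φ-pythagorean = identity
  where
  identity : ∀ u v →
    let a = u * u - v * v ; b = + 2 * u * v ; c = u * u + v * v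
    in  a * a + b * b ≡ c * c
  identity = solve-∀

module _ (β γ : ℤ) where

  δ : ℤ
  δ = + 1 - + 2 * γ

  -- InN β γ u v unfolds to norm (u , v) ≡ + 1.
  norm : ℤ × ℤ → ℤ
  norm (u , v) = sq u + + 2 * β * u * v - δ * sq v

  one : ℤ × ℤ
  one = + 1 , + 0

  infixl 7 _∙_
  _∙_ : ℤ × ℤ → ℤ × ℤ → ℤ × ℤ
  (u , v) ∙ (s , t) = u * s + δ * v * t , u * t + v * s + + 2 * β * v * t

  conj : ℤ × ℤ → ℤ × ℤ
  conj (u , v) = u + + 2 * β * v , - v

  infixl 7 _•_
  _•_ : Triple → Triple → Triple
  _•_ = bullet β γ

  Φ : ℤ × ℤ → Triple
  Φ = uncurry φ

  ∙-comm : ∀ p q → p ∙ q ≡ q ∙ p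
  ∙-comm (u , v) (s , t) = cong₂ _,_ (proj₁-identity γ u v s t) (proj₂-identity β u v s t)
    where
    proj₁-identity : ∀ γ u v s t → let δ = + 1 - + 2 * γ in
      u * s + δ * v * t ≡ s * u + δ * t * v
    proj₁-identity = solve-∀
    proj₂-identity : ∀ β u v s t →
      u * t + v * s + + 2 * β * v * t ≡ s * v + t * u + + 2 * β * t * v
    proj₂-identity = solve-∀

  ∙-assoc : ∀ p q r → (p ∙ q) ∙ r ≡ p ∙ (q ∙ r)
  ∙-assoc (u₁ , v₁) (u₂ , v₂) (u₃ , v₃) =
    cong₂ _,_ (proj₁-identity β γ u₁ v₁ u₂ v₂ u₃ v₃) (proj₂-identity β γ u₁ v₁ u₂ v₂ u₃ v₃)
    where
    proj₁-identity : ∀ β γ u₁ v₁ u₂ v₂ u₃ v₃ →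
      let δ = + 1 - + 2 * γ
          mul₁ u v s t = u * s + δ * v * t
          mul₂ u v s t = u * t + v * s + + 2 * β * v * t
      in  mul₁ (mul₁ u₁ v₁ u₂ v₂) (mul₂ u₁ v₁ u₂ v₂) u₃ v₃
          ≡ mul₁ u₁ v₁ (mul₁ u₂ v₂ u₃ v₃) (mul₂ u₂ v₂ u₃ v₃)
    proj₁-identity = solve-∀
    proj₂-identity : ∀ β γ u₁ v₁ u₂ v₂ u₃ v₃ →
      let δ = + 1 - + 2 * γ
          mul₁ u v s t = u * s + δ * v * t
          mul₂ u v s t = u * t + v * s + + 2 * β * v * t
      in  mul₂ (mul₁ u₁ v₁ u₂ v₂) (mul₂ u₁ v₁ u₂ v₂) u₃ v₃
          ≡ mul₂ u₁ v₁ (mul₁ u₂ v₂ u₃ v₃) (mul₂ u₂ v₂ u₃ v₃)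
    proj₂-identity = solve-∀

  ∙-identityʳ : ∀ p → p ∙ one ≡ p
  ∙-identityʳ (u , v) = cong₂ _,_ (proj₁-identity γ u v) (proj₂-identity β u v)
    where
    proj₁-identity : ∀ γ u v → u * + 1 + (+ 1 - + 2 * γ) * v * + 0 ≡ u
    proj₁-identity = solve-∀
    proj₂-identity : ∀ β u v → u * + 0 + v * + 1 + + 2 * β * v * + 0 ≡ v
    proj₂-identity = solve-∀

  ∙-identityˡ : ∀ p → one ∙ p ≡ p
  ∙-identityˡ p = trans (∙-comm one p) (∙-identityʳ p)

  ∙-conjʳ : ∀ p → p ∙ conj p ≡ (norm p , + 0)
  ∙-conjʳ (u , v) = cong₂ _,_ (proj₁-identity β γ u v) (proj₂-identity β u v)
    where
    proj₁-identity : ∀ β γ u v → let δ = + 1 - + 2 * γ in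
      u * (u + + 2 * β * v) + δ * v * - v ≡ u * u + + 2 * β * u * v - δ * (v * v)
    proj₁-identity = solve-∀
    proj₂-identity : ∀ β u v → u * - v + v * (u + + 2 * β * v) + + 2 * β * v * - v ≡ + 0
    proj₂-identity = solve-∀

  norm-∙ : ∀ p q → norm (p ∙ q) ≡ norm p * norm q
  norm-∙ (u , v) (s , t) = identity β γ u v s t
    where
    identity : ∀ β γ u v s t →
      let δ = + 1 - + 2 * γ
          N a b = a * a + + 2 * β * a * b - δ * (b * b)
      in  N (u * s + δ * v * t) (u * t + v * s + + 2 * β * v * t) ≡ N u v * N s t
    identity = solve-∀

  norm-one : norm one ≡ + 1
  norm-one = identity β γ
    where
    identity : ∀ β γ → + 1 * + 1 + + 2 * β * + 1 * + 0 - (+ 1 - + 2 * γ) * (+ 0 * + 0) ≡ + 1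
    identity = solve-∀

  norm-conj : ∀ p → norm (conj p) ≡ norm p
  norm-conj (u , v) = identity β γ u v
    where
    identity : ∀ β γ u v →
      let δ = + 1 - + 2 * γ
          N a b = a * a + + 2 * β * a * b - δ * (b * b)
      in  N (u + + 2 * β * v) (- v) ≡ N u v
    identity = solve-∀

  φ-∙ : ∀ p q → Φ p • Φ q ≡ Φ (p ∙ q)
  φ-∙ (u , v) (s , t) =
    ⟨,,⟩-cong (x-identity β γ u v s t) (y-identity β γ u v s t) (z-identity β γ u v s t)
    where
    x-identity : ∀ β γ u v s t →
      let δ = + 1 - + 2 * γ
          P = u * s + δ * v * t ; Q = u * t + v * s + + 2 * β * v * t
          a = u * u - v * v ; b = + 2 * u * v ; c = u * u + v * v ; d = a - c
          dot₃ k l m = k * (s * s - t * t) + l * (+ 2 * s * t) + m * (s * s + t * t)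
      in  dot₃ ((γ * γ - γ + + 1 - β * β) * d + β * b + c)
               (β * d - γ * b)
               ((β * β - γ * γ + γ) * d - β * b)
          ≡ P * P - Q * Q
    x-identity = solve-∀
    y-identity : ∀ β γ u v s t →
      let δ = + 1 - + 2 * γ
          P = u * s + δ * v * t ; Q = u * t + v * s + + 2 * β * v * t
          a = u * u - v * v ; b = + 2 * u * v ; c = u * u + v * v ; d = a - c
          dot₃ k l m = k * (s * s - t * t) + l * (+ 2 * s * t) + m * (s * s + t * t)
      in  dot₃ (- (β * (+ 2 * γ - + 1) * d) + γ * b)
               (γ * d + β * b + c)
               (β * (+ 2 * γ - + 1) * d + (+ 1 - γ) * b)
          ≡ + 2 * P * Q
    y-identity = solve-∀
    z-identity : ∀ β γ u v s t →
      let δ = + 1 - + 2 * γ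
          P = u * s + δ * v * t ; Q = u * t + v * s + + 2 * β * v * t
          a = u * u - v * v ; b = + 2 * u * v ; c = u * u + v * v ; d = a - c
          dot₃ k l m = k * (s * s - t * t) + l * (+ 2 * s * t) + m * (s * s + t * t)
      in  dot₃ ((β * β + γ * γ - γ) * d - β * b)
               (- (β * d) + (+ 1 - γ) * b)
               (- ((β * β + γ * γ - γ) * d) + β * b + c)
          ≡ P * P + Q * Q
    z-identity = solve-∀

  conj-inverseʳ : ∀ p → norm p ≡ + 1 → p ∙ conj p ≡ one
  conj-inverseʳ p normp≡1 = trans (∙-conjʳ p) (cong (_, + 0) normp≡1)

  conj-inverseˡ : ∀ p → norm p ≡ + 1 → conj p ∙ p ≡ one
  conj-inverseˡ p normp≡1 = trans (∙-comm (conj p) p) (conj-inverseʳ p normp≡1)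

  Φ-inIm : ∀ p → norm p ≡ + 1 → InIm β γ (Φ p)
  Φ-inIm (u , v) normp≡1 = u , v , normp≡1 , refl

  •-assoc-Φ : ∀ p q r → (Φ p • Φ q) • Φ r ≡ Φ p • (Φ q • Φ r)
  •-assoc-Φ p q r = begin
    (Φ p • Φ q) • Φ r   ≡⟨ cong (_• Φ r) (φ-∙ p q) ⟩
    Φ (p ∙ q) • Φ r     ≡⟨ φ-∙ (p ∙ q) r ⟩
    Φ (p ∙ q ∙ r)       ≡⟨ cong Φ (∙-assoc p q r) ⟩
    Φ (p ∙ (q ∙ r))     ≡⟨ φ-∙ p (q ∙ r) ⟨
    Φ p • Φ (q ∙ r)     ≡⟨ cong (Φ p •_) (φ-∙ q r) ⟨
    Φ p • (Φ q • Φ r)   ∎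
    where open ≡-Reasoning

  inIm-pythagorean : ∀ a → InIm β γ a → Pythagorean a
  inIm-pythagorean _ (u , v , _ , refl) = φ-pythagorean u v

  inIm-• : ∀ a b → InIm β γ a → InIm β γ b → InIm β γ (a • b)
  inIm-• _ _ (u , v , norm₁≡1 , refl) (s , t , norm₂≡1 , refl) =
    subst (InIm β γ) (sym (φ-∙ p q))
      (Φ-inIm (p ∙ q) (trans (norm-∙ p q) (cong₂ _*_ norm₁≡1 norm₂≡1)))
    where
    p q : ℤ × ℤ
    p = u , v
    q = s , t

  inIm-•-assoc : ∀ a b c → InIm β γ a → InIm β γ b → InIm β γ c → (a • b) • c ≡ a • (b • c)
  inIm-•-assoc _ _ _ (u₁ , v₁ , _ , refl) (u₂ , v₂ , _ , refl) (u₃ , v₃ , _ , refl) =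
    •-assoc-Φ (u₁ , v₁) (u₂ , v₂) (u₃ , v₃)

  inIm-•-identity : ∀ a → InIm β γ a → e • a ≡ a × a • e ≡ a
  inIm-•-identity _ (u , v , _ , refl) =
    trans (φ-∙ one p) (cong Φ (∙-identityˡ p)) , trans (φ-∙ p one) (cong Φ (∙-identityʳ p))
    where
    p : ℤ × ℤ
    p = u , v

  conj-inverse : ∀ p → norm p ≡ + 1 →
    norm (conj p) ≡ + 1 × Φ p • Φ (conj p) ≡ e × Φ (conj p) • Φ p ≡ e
  conj-inverse p normp≡1 =
    trans (norm-conj p) normp≡1 ,
    trans (φ-∙ p (conj p)) (cong Φ (conj-inverseʳ p normp≡1)) ,
    trans (φ-∙ (conj p) p) (cong Φ (conj-inverseˡ p normp≡1))

mainTheorem6 : (β γ : ℤ) →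
    -- elements of Im(φ̄) are Pythagorean triples
    ((t : Triple) → InIm β γ t → Pythagorean t)
    -- closure under •
    × ((a b : Triple) → InIm β γ a → InIm β γ b → InIm β γ (bullet β γ a b))
    -- associativity on Im(φ̄)
    × ((a b c : Triple) → InIm β γ a → InIm β γ b → InIm β γ c →
         bullet β γ (bullet β γ a b) c ≡ bullet β γ a (bullet β γ b c))
    -- identity (1,0,1) lies in Im(φ̄) and is a two-sided identity
    × InIm β γ e
    × ((a : Triple) → InIm β γ a → bullet β γ e a ≡ a × bullet β γ a e ≡ a)
    -- inverse of φ(u,v) is φ(u+2βv,−v), which lies in Im(φ̄)
    × ((u v : ℤ) → InN β γ u v →
         InN β γ (u + (+ 2) * β * v) (- v)
         × bullet β γ (φ u v) (φ (u + (+ 2) * β * v) (- v)) ≡ e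
         × bullet β γ (φ (u + (+ 2) * β * v) (- v)) (φ u v) ≡ e)
mainTheorem6 β γ =
  inIm-pythagorean β γ ,
  inIm-• β γ ,
  inIm-•-assoc β γ ,
  Φ-inIm β γ (one β γ) (norm-one β γ) ,
  inIm-•-identity β γ ,
  λ u v → conj-inverse β γ (u , v)
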